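{- Let $b$ be a positive integer. If $N$ is a Midy's number to base $b$, then $N$ is a strong pseudoprime to base $b$.
   Context: For coprime positive integers $M,b$, $|b|_M$ denotes the multiplicative order of $b$ modulo $M$, and $\mathbb{U}_M$ is the group of positive integers less than $M$ and coprime to $M$. Midy's property: let $|b|_M=kd$ with $d>1$, and for $x\in\mathbb{U}_M$ write $x/M=0.\overline{a_1a_2\cdots a_{|b|_M}}$ in base $b$ (the bar marks the period). Split the period into $d$ blocks of length $k$, let $A_j$ be the number written in base $b$ by the $j$-th block, and $S_d(x)=\sum_{j=1}^d A_j$. $M$ has the Midy's property for $b$ and $d$ if $b^k-1$ divides $S_d(x)$ for every $x\in\mathbb{U}_M$; $\mathcal{M}_b(M)$ is the set of divisors $d$ of $|b|_M$ for which this holds. A Midy's number to base $b$ is an odd composite number $M$ coprime to both $b$ and $|b|_M$ such that every divisor $d>1$ of $|b|_M$ lies in $\mathcal{M}_b(M)$; by convention $b=1$ is allowed (then $|1|_M=1$ and the divisor condition is vacuous). It is known that an odd composite $M$ coprime to $b$ is a Midy's number to base $b$ if and only if $|b|_M=|b|_p$ for every prime $p\mid M$. An odd composite $N$ with $N-1=2^s t$, $t$ odd, and $\gcd(b,N)=1$ is a strong pseudoprime to base $b$ if either $b^t\equiv 1 \pmod N$ or $b^{2^i t}\equiv -1\pmod N$ for some $0\le i<s$. -}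

module Defs where

open import Data.Nat using (ℕ; zero; suc; _+_; _*_; _∸_; _^_; _≤_; _<_)
open import Data.Nat.DivMod using (_/_; _%_)
open import Data.Nat.Divisibility using (_∣_)
open import Data.Nat.Coprimality using (Coprime)
open import Data.Nat.Primality using (Composite)
open import Data.Product using (_×_; ∃-syntax)
open import Data.Sum using (_⊎_)
open import Relation.Nullary using (¬_)
open import Relation.Binary.PropositionalEquality using (_≡_)

Odd : ℕ → Set
Odd n = ¬ (2 ∣ n)

-- Congruences B^e ≡ 1 (mod M) (with B ≥ 1) are written M ∣ B^e ∸ 1,
-- and B^e ≡ -1 (mod M) is written M ∣ B^e + 1.

MultOrder : ℕ → ℕ → ℕ → Set
MultOrder M b k =
  1 ≤ k × M ∣ (b ^ k ∸ 1) × (∀ j → 1 ≤ j → M ∣ (b ^ j ∸ 1) → k ≤ j)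

InU : ℕ → ℕ → Set
InU M x = 1 ≤ x × x < M × Coprime x M

-- i-th digit (i ≥ 1) of the base-b expansion of x / M (0 ≤ x < M):
-- a_i = ⌊ b · ((x · b^(i-1)) mod M) / M ⌋.  (M = 0 never used.)
digit : ℕ → ℕ → ℕ → ℕ → ℕ
digit b zero    x i = 0
digit b (suc m) x i = (b * ((x * b ^ (i ∸ 1)) % suc m)) / suc m

sumBelow : (ℕ → ℕ) → ℕ → ℕ
sumBelow f zero    = 0
sumBelow f (suc n) = sumBelow f n + f n

-- A_{j+1} (j = 0 … d-1): the number written in base b by the (j+1)-th
-- block of k digits a_{jk+1} … a_{jk+k}
block : ℕ → ℕ → ℕ → ℕ → ℕ → ℕ
block b M x k j = sumBelow (λ i → digit b M x (j * k + i + 1) * b ^ (k ∸ (i + 1))) k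

S : ℕ → ℕ → ℕ → ℕ → ℕ → ℕ
S b M x k d = sumBelow (block b M x k) d

MidyProperty : ℕ → ℕ → ℕ → Set
MidyProperty b M d =
  ∀ n k → MultOrder M b n → n ≡ k * d → ∀ x → InU M x → (b ^ k ∸ 1) ∣ S b M x k d

MidyNumber : ℕ → ℕ → Set
MidyNumber b M =
  Odd M × Composite M × Coprime M b ×
  (∀ n → MultOrder M b n →
     Coprime M n × (∀ d → 1 < d → d ∣ n → MidyProperty b M d))

StrongPseudoprime : ℕ → ℕ → Set
StrongPseudoprime b N =
  Odd N × Composite N × Coprime b N ×
  (∀ s t → N ∸ 1 ≡ 2 ^ s * t → Odd t →
     N ∣ (b ^ t ∸ 1) ⊎ ∃[ i ] (i < s × N ∣ (b ^ (2 ^ i * t) + 1)))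

-- Let n = |b|_N and n = k d with d > 1. Long division of 1 by N in base b gives
-- b^n = N T + 1, where T is the number written by the period; reading the period in
-- base b^k, whose digits are the blocks A_j, shows T ≡ S_d(1) ≡ 0 (mod b^k − 1), so
-- N divides 1 + b^k + ⋯ + b^(k(d−1)). For a prime p ∣ N with e = |b|_p and n = r e,
-- r > 1, this sum with k = e is ≡ r (mod p), so p ∣ r ∣ n, against gcd(N, n) = 1.
-- Hence |b|_p = n, which divides p − 1 by Fermat, and so n ∣ N − 1 = 2^s t. If n ∤ t,
-- pick i < s with n ∤ 2^i t and n ∣ 2^(i+1) t: then n is even, 2^i t is an odd
-- multiple of n/2, and d = 2 gives b^(n/2) ≡ −1 (mod N), so b^(2^i t) ≡ −1 (mod N).
{-# OPTIONS --safe #-}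
module Submission where

open import Defs
open import Data.Nat
open import Data.Nat.Properties
open import Data.Nat.Divisibility
open import Data.Nat.DivMod
open import Data.Nat.Coprimality using (Coprime; coprime-divisor; 1-coprimeTo) renaming (sym to coprime-sym)
open import Data.Nat.Primality using (Prime; euclidsLemma; ¬prime[1]; prime⇒nonTrivial; composite⇒nonTrivial)
open import Data.Nat.Primality.Factorisation using (factorise)
open import Data.Nat.Combinatorics
  using (_C_; nCn≡1; k>n⇒nCk≡0; nCk+nC[k+1]≡[n+1]C[k+1]; nCk≡n!/k![n-k]!; k![n∸k]!∣n!)
open import Data.Nat.ListAction using (product)
open import Data.Nat.Tactic.RingSolver using (solve-∀)
open import Algebra.Properties.CommutativeSemigroup *-commutativeSemigroup using (x∙yz≈y∙xz)
open import Data.List using ([]; _∷_)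
open import Data.List.Relation.Unary.All using (All; []; _∷_)
open import Data.Fin using (Fin; toℕ; fromℕ<)
open import Data.Fin.Properties using (pigeonhole; toℕ-fromℕ<)
open import Data.Product
open import Data.Sum
open import Data.Empty
open import Function using (_∘_; id)
open import Relation.Unary using (Decidable)
open import Relation.Nullary
open import Relation.Nullary.Decidable using (_×-dec_)
open import Relation.Binary.PropositionalEquality
open ≡-Reasoning

sumBelow-cong : ∀ {f g : ℕ → ℕ} n → (∀ i → i < n → f i ≡ g i) → sumBelow f n ≡ sumBelow g n
sumBelow-cong zero    f≡g = refl
sumBelow-cong (suc n) f≡g =
  cong₂ _+_ (sumBelow-cong n (λ i i<n → f≡g i (m<n⇒m<1+n i<n))) (f≡g n ≤-refl)

sumBelow-+ : ∀ (f g : ℕ → ℕ) n → sumBelow (λ i → f i + g i) n ≡ sumBelow f n + sumBelow g n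
sumBelow-+ f g zero    = refl
sumBelow-+ f g (suc n) rewrite sumBelow-+ f g n = +-interchange (sumBelow f n) (sumBelow g n) (f n) (g n)
  where +-interchange : ∀ a b c d → a + b + (c + d) ≡ a + c + (b + d)
        +-interchange = solve-∀

sumBelow-*ˡ : ∀ c (f : ℕ → ℕ) n → sumBelow (λ i → c * f i) n ≡ c * sumBelow f n
sumBelow-*ˡ c f zero    = sym (*-zeroʳ c)
sumBelow-*ˡ c f (suc n) rewrite sumBelow-*ˡ c f n = sym (*-distribˡ-+ c (sumBelow f n) (f n))

sumBelow-suc : ∀ (f : ℕ → ℕ) n → sumBelow f (suc n) ≡ f 0 + sumBelow (f ∘ suc) n
sumBelow-suc f zero    = +-comm 0 (f 0)
sumBelow-suc f (suc n) rewrite sumBelow-suc f n = +-assoc (f 0) _ _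

∣sumBelow : ∀ {m} (f : ℕ → ℕ) n → (∀ i → i < n → m ∣ f i) → m ∣ sumBelow f n
∣sumBelow f zero    m∣f = _ ∣0
∣sumBelow f (suc n) m∣f =
  ∣m∣n⇒∣m+n (∣sumBelow f n (λ i i<n → m∣f i (m<n⇒m<1+n i<n))) (m∣f n ≤-refl)

-- Congruence to 1, phrased without truncated subtraction.

infix 4 _≡1[mod_]
_≡1[mod_] : ℕ → ℕ → Set
a ≡1[mod m ] = ∃[ z ] a ≡ 1 + z × m ∣ z

≡1-refl : ∀ {m} → 1 ≡1[mod m ]
≡1-refl = 0 , refl , _ ∣0

≡1-* : ∀ {m a c} → a ≡1[mod m ] → c ≡1[mod m ] → a * c ≡1[mod m ]
≡1-* (z , refl , m∣z) (w , refl , m∣w) =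
  z + w + z * w , expand z w , ∣m∣n⇒∣m+n (∣m∣n⇒∣m+n m∣z m∣w) (∣m⇒∣m*n w m∣z)
  where expand : ∀ z w → (1 + z) * (1 + w) ≡ 1 + (z + w + z * w)
        expand = solve-∀

≡1-^ : ∀ {m a} e → a ≡1[mod m ] → a ^ e ≡1[mod m ]
≡1-^ zero    a≡1 = ≡1-refl
≡1-^ (suc e) a≡1 = ≡1-* a≡1 (≡1-^ e a≡1)

≡1-cancelˡ : ∀ {m a c} → a ≡1[mod m ] → a * c ≡1[mod m ] → c ≡1[mod m ]
≡1-cancelˡ {a = a} {zero} _ (w , a*0≡1+w , _) = ⊥-elim (0≢1+n (trans (sym (*-zeroʳ a)) a*0≡1+w))
≡1-cancelˡ {m} {c = suc c} (z , refl , m∣z) (w , ac≡1+w , m∣w) =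
  c , refl , ∣m+n∣m⇒∣n (subst (m ∣_) (sym zc+c≡w) m∣w) (∣m⇒∣m*n (suc c) m∣z)
  where
    expand : ∀ z c → (1 + z) * suc c ≡ suc (z * suc c + c)
    expand = solve-∀
    zc+c≡w : z * suc c + c ≡ w
    zc+c≡w = suc-injective (trans (sym (expand z c)) ac≡1+w)

≡1-∣ : ∀ {m m′ a} → m′ ∣ m → a ≡1[mod m ] → a ≡1[mod m′ ]
≡1-∣ m′∣m (z , a≡1+z , m∣z) = z , a≡1+z , ∣-trans m′∣m m∣z

≡1⇒∣∸1 : ∀ {m a} → a ≡1[mod m ] → m ∣ a ∸ 1
≡1⇒∣∸1 (z , refl , m∣z) = m∣z

∣∸1⇒≡1 : ∀ {m a} → 1 ≤ a → m ∣ a ∸ 1 → a ≡1[mod m ]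
∣∸1⇒≡1 {a = suc a} _ m∣a = a , refl , m∣a

geometric : ℕ → ℕ → ℕ
geometric x e = sumBelow (x ^_) e

suc^≡1+geometric : ∀ y e → suc y ^ e ≡ 1 + y * geometric (suc y) e
suc^≡1+geometric y zero    = cong suc (sym (*-zeroʳ y))
suc^≡1+geometric y (suc e) rewrite suc^≡1+geometric y e = expand y (geometric (suc y) e)
  where expand : ∀ y g → suc y * (1 + y * g) ≡ 1 + y * (g + (1 + y * g))
        expand = solve-∀

geometric≡length[mod] : ∀ {p x} → x ≡1[mod p ] → ∀ q → ∃[ w ] geometric x q ≡ w + q × p ∣ w
geometric≡length[mod] x≡1 zero    = 0 , refl , _ ∣0
geometric≡length[mod] x≡1 (suc q) with geometric≡length[mod] x≡1 q | ≡1-^ q x≡1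
... | w , G≡w+q , p∣w | z , x^q≡1+z , p∣z =
  w + z , trans (cong₂ _+_ G≡w+q x^q≡1+z) (regroup q w z) , ∣m∣n⇒∣m+n p∣w p∣z
  where regroup : ∀ q w z → w + q + (1 + z) ≡ w + z + suc q
        regroup = solve-∀

∣geometric⇒∣length : ∀ {p x} → x ≡1[mod p ] → ∀ q → p ∣ geometric x q → p ∣ q
∣geometric⇒∣length x≡1 q p∣G with geometric≡length[mod] x≡1 q
... | w , G≡w+q , p∣w = ∣m+n∣m⇒∣n (subst (_ ∣_) G≡w+q p∣G) p∣w

-- Base-b numerals and long division

-- block b M x k j unfolds to baseValue b (digit b M x) (j * k) k.
baseValue : ℕ → (ℕ → ℕ) → ℕ → ℕ → ℕ
baseValue B a c m = sumBelow (λ i → a (c + i + 1) * B ^ (m ∸ (i + 1))) m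

baseValue-suc : ∀ B a c m → baseValue B a c (suc m) ≡ B * baseValue B a c m + a (c + m + 1)
baseValue-suc B a c m =
  cong₂ _+_ (trans (sumBelow-cong m shiftDigit) (sumBelow-*ˡ B (λ i → a (c + i + 1) * B ^ (m ∸ (i + 1))) m))
            lastDigit
  where
    shiftDigit : ∀ i → i < m →
      a (c + i + 1) * B ^ (suc m ∸ (i + 1)) ≡ B * (a (c + i + 1) * B ^ (m ∸ (i + 1)))
    shiftDigit i i<m = trans (cong (λ e → a (c + i + 1) * B ^ e) (+-∸-assoc 1 (subst (_≤ m) (+-comm 1 i) i<m)))
                             (x∙yz≈y∙xz (a (c + i + 1)) B _)
    lastDigit : a (c + m + 1) * B ^ (suc m ∸ (m + 1)) ≡ a (c + m + 1)
    lastDigit rewrite +-comm m 1 | n∸n≡0 m = *-identityʳ _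

baseValue≡digitSum+multiple : ∀ y a c m →
  ∃[ W ] baseValue (suc y) a c m ≡ sumBelow (λ i → a (c + i + 1)) m + y * W
baseValue≡digitSum+multiple y a c zero    = 0 , sym (*-zeroʳ y)
baseValue≡digitSum+multiple y a c (suc m) with baseValue≡digitSum+multiple y a c m
... | W , V≡Σa+yW = W + V , (begin
    baseValue (suc y) a c (suc m)          ≡⟨ baseValue-suc (suc y) a c m ⟩
    suc y * V + a (c + m + 1)              ≡⟨ cong (λ v → v + y * V + a (c + m + 1)) V≡Σa+yW ⟩
    Σa + y * W + y * V + a (c + m + 1)     ≡⟨ regroup Σa (a (c + m + 1)) y W V ⟩
    Σa + a (c + m + 1) + y * (W + V)       ∎)
  where
    V = baseValue (suc y) a c m
    Σa = sumBelow (λ i → a (c + i + 1)) m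
    regroup : ∀ s a y W V → s + y * W + y * V + a ≡ s + a + y * (W + V)
    regroup = solve-∀

∣digitSum⇒∣baseValue : ∀ {B} → 1 ≤ B → ∀ a c m →
  (B ∸ 1) ∣ sumBelow (λ i → a (c + i + 1)) m → (B ∸ 1) ∣ baseValue B a c m
∣digitSum⇒∣baseValue {suc y} _ a c m y∣Σa with baseValue≡digitSum+multiple y a c m
... | W , V≡Σa+yW = subst (y ∣_) (sym V≡Σa+yW) (∣m∣n⇒∣m+n y∣Σa (m∣m*n W))

longDivision : ∀ B N (r a : ℕ → ℕ) → (∀ c → B * r c ≡ N * a (suc c) + r (suc c)) →
  ∀ c m → B ^ m * r c ≡ N * baseValue B a c m + r (c + m)
longDivision B N r a step c zero =
  trans (*-identityˡ (r c)) (sym (cong₂ _+_ (*-zeroʳ N) (cong r (+-identityʳ c))))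
longDivision B N r a step c (suc m) = begin
    B * B ^ m * r c                                   ≡⟨ *-assoc B (B ^ m) (r c) ⟩
    B * (B ^ m * r c)                                 ≡⟨ cong (B *_) (longDivision B N r a step c m) ⟩
    B * (N * V + r (c + m))                           ≡⟨ *-distribˡ-+ B (N * V) (r (c + m)) ⟩
    B * (N * V) + B * r (c + m)                       ≡⟨ cong (B * (N * V) +_) (step (c + m)) ⟩
    B * (N * V) + (N * a (suc (c + m)) + r (suc (c + m)))
                                                      ≡⟨ regroup B N V (a (suc (c + m))) (r (suc (c + m))) ⟩
    N * (B * V + a (suc (c + m))) + r (suc (c + m))   ≡⟨ cong₂ (λ d e → N * (B * V + a d) + r e)
                                                               (+-comm 1 (c + m)) (sym (+-suc c m)) ⟩
    N * (B * V + a (c + m + 1)) + r (c + suc m)       ≡⟨ cong (λ v → N * v + r (c + suc m))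
                                                               (baseValue-suc B a c m) ⟨
    N * baseValue B a c (suc m) + r (c + suc m)       ∎
  where
    V = baseValue B a c m
    regroup : ∀ B N V x y → B * (N * V) + (N * x + y) ≡ N * (B * V + x) + y
    regroup = solve-∀

-- Long division of x by N in base b: the c-th remainder is x b^c mod N, and the
-- quotients are the digits of x / N.
module Expansion (b N′ x : ℕ) where

  private
    N : ℕ
    N = suc N′

  remainder : ℕ → ℕ
  remainder c = x * b ^ c % N

  digitStep : ∀ c → b * remainder c ≡ N * digit b N x (suc c) + remainder (suc c)
  digitStep c = begin
      b * remainder c                               ≡⟨ m≡m%n+[m/n]*n (b * remainder c) N ⟩
      b * remainder c % N + digit b N x (suc c) * N ≡⟨ cong₂ _+_ nextRemainder (*-comm _ N) ⟩
      remainder (suc c) + N * digit b N x (suc c)   ≡⟨ +-comm (remainder (suc c)) _ ⟩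
      N * digit b N x (suc c) + remainder (suc c)   ∎
    where
      nextRemainder : b * remainder c % N ≡ remainder (suc c)
      nextRemainder = begin
        b * (x * b ^ c % N) % N         ≡⟨ %-distribˡ-* b (x * b ^ c % N) N ⟩
        b % N * (x * b ^ c % N % N) % N ≡⟨ cong (λ z → b % N * z % N) (m%n%n≡m%n (x * b ^ c) N) ⟩
        b % N * (x * b ^ c % N) % N     ≡⟨ %-distribˡ-* b (x * b ^ c) N ⟨
        b * (x * b ^ c) % N             ≡⟨ cong (_% N) (x∙yz≈y∙xz b x (b ^ c)) ⟩
        x * (b * b ^ c) % N             ∎

  blockStep : ∀ k j → b ^ k * remainder (j * k) ≡ N * block b N x k j + remainder (suc j * k)
  blockStep k j = trans (longDivision b N remainder (digit b N x) digitStep (j * k) k)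
                        (cong (λ e → N * block b N x k j + remainder e) (+-comm (j * k) k))

  -- The blocks are the digits of the same long division carried out in base b^k.
  periodExpansion : ∀ k d → (b ^ k) ^ d * remainder 0 ≡
    N * baseValue (b ^ k) (λ j → block b N x k (j ∸ 1)) 0 d + remainder (d * k)
  periodExpansion k d =
    longDivision (b ^ k) N (λ j → remainder (j * k)) (λ j → block b N x k (j ∸ 1)) (blockStep k) 0 d

  blockDigitSum : ∀ k d → sumBelow (λ i → block b N x k (0 + i + 1 ∸ 1)) d ≡ S b N x k d
  blockDigitSum k d = sumBelow-cong d (λ i _ → cong (block b N x k) (m+n∸n≡m i 1))

∣geometric : ∀ {B d N T} → 1 < B → B ^ d ≡ N * T + 1 → (B ∸ 1) ∣ T → N ∣ geometric B d
∣geometric {suc zero} (s≤s ())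
∣geometric {B@(suc (suc y))} {d} {N} {T} _ B^d≡NT+1 (divides q T≡q[B-1]) =
  divides q (*-cancelʳ-≡ _ _ (suc y) (begin
    geometric B d * suc y   ≡⟨ *-comm (geometric B d) (suc y) ⟩
    suc y * geometric B d   ≡⟨ suc-injective (trans (sym (suc^≡1+geometric (suc y) d))
                                                    (trans B^d≡NT+1 (+-comm (N * T) 1))) ⟩
    N * T                   ≡⟨ cong (N *_) T≡q[B-1] ⟩
    N * (q * suc y)         ≡⟨ *-assoc N q (suc y) ⟨
    N * q * suc y           ≡⟨ cong (_* suc y) (*-comm N q) ⟩
    q * N * suc y           ∎))

midy⇒∣geometric : ∀ {b N n k d} → 1 ≤ b → 1 < N → MultOrder N b n → n ≡ k * d → 1 < d →
                  MidyProperty b N d → N ∣ geometric (b ^ k) d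
midy⇒∣geometric {N = zero}     _ ()
midy⇒∣geometric {N = suc zero} _ (s≤s ())
midy⇒∣geometric {b} {N@(suc (suc N″))} {n} {k} {d} b≥1 _ order@(n≥1 , N∣b^n-1 , minimal) n≡kd d>1 midy =
  ∣geometric {d = d} {N = N} 1<b^k b^kd≡NT+1
    (∣digitSum⇒∣baseValue (<⇒≤ 1<b^k) blocks 0 d
      (subst (b ^ k ∸ 1 ∣_) (sym (blockDigitSum k d)) b^k-1∣S))
  where
    open Expansion b (suc N″) 1
    blocks : ℕ → ℕ
    blocks j = block b N 1 k (j ∸ 1)
    k≥1 : 1 ≤ k
    k≥1 = ≰⇒> (λ k≤0 → <⇒≢ n≥1 (sym (trans n≡kd (cong (_* d) (n≤0⇒n≡0 k≤0)))))
    k<n : k < n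
    k<n = subst (k <_) (sym n≡kd) (m<m*n k d {{>-nonZero k≥1}} d>1)
    1<b^k : 1 < b ^ k
    1<b^k = ≰⇒> λ b^k≤1 →
      <⇒≱ k<n (minimal k k≥1 (subst (N ∣_) (sym (m≤n⇒m∸n≡0 b^k≤1)) (N ∣0)))
    remainder-period : remainder (d * k) ≡ 1
    remainder-period with ∣∸1⇒≡1 (m^n>0 b {{>-nonZero b≥1}} n) N∣b^n-1
    ... | z , b^n≡1+z , N∣z = begin
      1 * b ^ (d * k) % N   ≡⟨ cong (λ e → 1 * b ^ e % N) (trans (*-comm d k) (sym n≡kd)) ⟩
      1 * b ^ n % N         ≡⟨ cong (_% N) (trans (*-identityˡ (b ^ n)) b^n≡1+z) ⟩
      (1 + z) % N           ≡⟨ %-remove-+ʳ 1 N∣z ⟩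
      1                     ∎
    b^kd≡NT+1 : (b ^ k) ^ d ≡ N * baseValue (b ^ k) blocks 0 d + 1
    b^kd≡NT+1 = trans (sym (*-identityʳ _))
                      (trans (periodExpansion k d) (cong (N * baseValue (b ^ k) blocks 0 d +_) remainder-period))
    b^k-1∣S : b ^ k ∸ 1 ∣ S b N 1 k d
    b^k-1∣S = midy n k order n≡kd 1 (≤-refl , s≤s (s≤s z≤n) , 1-coprimeTo N)

-- Fermat's little theorem

prime∣n!⇒≤ : ∀ {p} n → Prime p → p ∣ n ! → p ≤ n
prime∣n!⇒≤ zero    pr p∣1 = ⊥-elim (¬prime[1] (subst Prime (∣1⇒≡1 p∣1) pr))
prime∣n!⇒≤ (suc n) pr p∣[n+1]! with euclidsLemma (suc n) (n !) pr p∣[n+1]!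
... | inj₁ p∣n+1 = ∣⇒≤ p∣n+1
... | inj₂ p∣n!  = m≤n⇒m≤1+n (prime∣n!⇒≤ n pr p∣n!)

nCk*k![n∸k]!≡n! : ∀ {n k} → k ≤ n → (n C k) * (k ! * (n ∸ k) !) ≡ n !
nCk*k![n∸k]!≡n! {n} {k} k≤n = trans (cong (_* (k ! * (n ∸ k) !)) (nCk≡n!/k![n-k]! k≤n))
                                    (m/n*n≡m {{k !* (n ∸ k) !≢0}} (k![n∸k]!∣n! k≤n))

prime∣pCk : ∀ {p k} → Prime p → 0 < k → k < p → p ∣ p C k
prime∣pCk {p@(suc p′)} {k} pr 0<k k<p
  with euclidsLemma (p C k) (k ! * (p ∸ k) !) pr
         (subst (p ∣_) (sym (nCk*k![n∸k]!≡n! (<⇒≤ k<p))) (m∣m*n (p′ !)))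
... | inj₁ p∣pCk = p∣pCk
... | inj₂ p∣k![p∸k]! with euclidsLemma (k !) ((p ∸ k) !) pr p∣k![p∸k]!
...   | inj₁ p∣k!     = ⊥-elim (<⇒≱ k<p (prime∣n!⇒≤ k pr p∣k!))
...   | inj₂ p∣[p∸k]! =
  ⊥-elim (<⇒≱ (∸-monoʳ-< 0<k (<⇒≤ k<p)) (prime∣n!⇒≤ (p ∸ k) pr p∣[p∸k]!))

binomial : ∀ x n → suc x ^ n ≡ 1 + sumBelow (λ k → (n C suc k) * x ^ suc k) n
binomial x zero    = refl
binomial x (suc n) = begin
    suc x * suc x ^ n                               ≡⟨ cong (suc x *_) (binomial x n) ⟩
    suc x * (1 + M)                                 ≡⟨ regroup x M ⟩
    1 + (x * (1 + M) + M)                           ≡⟨ cong₂ (λ u v → 1 + (u + v)) lowerTerms upperTerms ⟨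
    1 + (sumBelow lower (suc n) + sumBelow upper (suc n)) ≡⟨ cong (1 +_) (sumBelow-+ lower upper (suc n)) ⟨
    1 + sumBelow (λ k → lower k + upper k) (suc n)   ≡⟨ cong (1 +_) (sumBelow-cong (suc n) (λ k _ → pascal k)) ⟩
    1 + sumBelow (λ k → (suc n C suc k) * x ^ suc k) (suc n) ∎
  where
    lower upper : ℕ → ℕ
    lower k = (n C k) * x ^ suc k
    upper k = (n C suc k) * x ^ suc k
    M = sumBelow upper n
    regroup : ∀ x M → suc x * (1 + M) ≡ 1 + (x * (1 + M) + M)
    regroup = solve-∀
    lowerTerms : sumBelow lower (suc n) ≡ x * (1 + M)
    lowerTerms = begin
      sumBelow lower (suc n)                         ≡⟨ sumBelow-cong (suc n) (λ k _ → x∙yz≈y∙xz (n C k) x (x ^ k)) ⟩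
      sumBelow (λ k → x * ((n C k) * x ^ k)) (suc n) ≡⟨ sumBelow-*ˡ x (λ k → (n C k) * x ^ k) (suc n) ⟩
      x * sumBelow (λ k → (n C k) * x ^ k) (suc n)   ≡⟨ cong (x *_) (sumBelow-suc (λ k → (n C k) * x ^ k) n) ⟩
      x * (1 + M)                                    ∎
    upperTerms : sumBelow upper (suc n) ≡ M
    upperTerms = trans (cong (λ c → M + c * x ^ suc n) (k>n⇒nCk≡0 (n<1+n n))) (+-identityʳ M)
    pascal : ∀ k → lower k + upper k ≡ (suc n C suc k) * x ^ suc k
    pascal k = trans (sym (*-distribʳ-+ (x ^ suc k) (n C k) (n C suc k)))
                     (cong (_* x ^ suc k) (nCk+nC[k+1]≡[n+1]C[k+1] n k))

freshmansDream : ∀ {p} → Prime p → ∀ x → ∃[ Z ] suc x ^ p ≡ 1 + Z + x ^ p × p ∣ Z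
freshmansDream {p@(suc p′)} pr x = Z , (begin
    suc x ^ p                  ≡⟨ binomial x p ⟩
    1 + (Z + (p C p) * x ^ p)  ≡⟨ cong (λ c → 1 + (Z + c * x ^ p)) (nCn≡1 p) ⟩
    1 + (Z + 1 * x ^ p)        ≡⟨ cong (λ y → 1 + (Z + y)) (*-identityˡ (x ^ p)) ⟩
    1 + Z + x ^ p              ∎)
  , ∣sumBelow (λ k → (p C suc k) * x ^ suc k) p′
      (λ k k<p′ → ∣m⇒∣m*n (x ^ suc k) (prime∣pCk pr z<s (s≤s k<p′)))
  where Z = sumBelow (λ k → (p C suc k) * x ^ suc k) p′

x^p≡x[mod-p] : ∀ {p} → Prime p → ∀ x → ∃[ W ] x ^ p ≡ x + W × p ∣ W
x^p≡x[mod-p] {suc p′} pr zero    = 0 , refl , _ ∣0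
x^p≡x[mod-p]          pr (suc x) with x^p≡x[mod-p] pr x | freshmansDream pr x
... | W , x^p≡x+W , p∣W | Z , [1+x]^p≡1+Z+x^p , p∣Z =
  Z + W , trans [1+x]^p≡1+Z+x^p (trans (cong (1 + Z +_) x^p≡x+W) (regroup Z x W)) , ∣m∣n⇒∣m+n p∣Z p∣W
  where regroup : ∀ Z x W → 1 + Z + (x + W) ≡ suc x + (Z + W)
        regroup = solve-∀

fermat : ∀ {p x} → Prime p → ¬ p ∣ x → x ^ (p ∸ 1) ≡1[mod p ]
fermat {suc p′} {x} pr p∤x with x ^ p′ | x^p≡x[mod-p] pr x
... | zero  | W , x*0≡x+W , _ = ⊥-elim (p∤x (subst (_ ∣_) (sym x≡0) (_ ∣0)))
  where x≡0 : x ≡ 0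
        x≡0 = m+n≡0⇒m≡0 x (trans (sym x*0≡x+W) (*-zeroʳ x))
... | suc y | W , x*[1+y]≡x+W , p∣W = y , refl , [ ⊥-elim ∘ p∤x , id ]′ (euclidsLemma x y pr p∣xy)
  where p∣xy : suc p′ ∣ x * y
        p∣xy = subst (_ ∣_) (sym (+-cancelˡ-≡ x _ _ (trans (sym (*-suc x y)) x*[1+y]≡x+W))) p∣W

-- Multiplicative orders

leastBelow : ∀ {P : ℕ → Set} → Decidable P → ∀ e →
  (∃[ m ] P m × (∀ j → P j → m ≤ j)) ⊎ (∀ j → j < e → ¬ P j)
leastBelow dec zero = inj₂ (λ _ ())
leastBelow dec (suc e) with leastBelow dec e
... | inj₁ least = inj₁ least
... | inj₂ none with dec e
...   | yes pe = inj₁ (e , pe , λ j pj → ≮⇒≥ (λ j<e → none j j<e pj))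
...   | no ¬pe =
  inj₂ (λ j j<1+e → [ none j , (λ { refl → ¬pe }) ]′ (m≤n⇒m<n∨m≡n (≤-pred j<1+e)))

leastWitness : ∀ {P : ℕ → Set} → Decidable P → ∀ {e} → P e → ∃[ m ] P m × (∀ j → P j → m ≤ j)
leastWitness dec {e} pe with leastBelow dec (suc e)
... | inj₁ least = least
... | inj₂ none  = ⊥-elim (none e ≤-refl pe)

∣b^i*c⇒∣c : ∀ {M b} → Coprime M b → ∀ i {c} → M ∣ b ^ i * c → M ∣ c
∣b^i*c⇒∣c coprime zero {c} M∣c = subst (_ ∣_) (+-identityʳ c) M∣c
∣b^i*c⇒∣c {M} {b} coprime (suc i) {c} M∣b^[1+i]c =
  ∣b^i*c⇒∣c coprime i (coprime-divisor coprime (subst (M ∣_) (*-assoc b (b ^ i) c) M∣b^[1+i]c))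

%-≡⇒∣ : ∀ N .{{_ : NonZero N}} a x → a % N ≡ (a + x) % N → N ∣ x
%-≡⇒∣ N a x a≡a+x =
  ∣m+n∣m⇒∣n (subst (N ∣_) (sym qN+x≡q′N) (n∣m*n ((a + x) / N))) (n∣m*n (a / N))
  where
    qN+x≡q′N : a / N * N + x ≡ (a + x) / N * N
    qN+x≡q′N = +-cancelˡ-≡ (a % N) _ _ (begin
      a % N + (a / N * N + x)       ≡⟨ +-assoc (a % N) _ x ⟨
      a % N + a / N * N + x         ≡⟨ cong (_+ x) (m≡m%n+[m/n]*n a N) ⟨
      a + x                         ≡⟨ m≡m%n+[m/n]*n (a + x) N ⟩
      (a + x) % N + (a + x) / N * N ≡⟨ cong (_+ (a + x) / N * N) a≡a+x ⟨
      a % N + (a + x) / N * N       ∎)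

-- Two of b^0, …, b^M agree modulo M, and b is invertible modulo M.
powerCongruentToOne : ∀ {M b} → 1 ≤ M → 1 ≤ b → Coprime M b → ∃[ e ] 1 ≤ e × b ^ e ≡1[mod M ]
powerCongruentToOne {M} {b} 1≤M b≥1 coprime
  with pigeonhole ≤-refl (λ (i : Fin (suc M)) → fromℕ< (m%n<n (b ^ toℕ i) M {{>-nonZero 1≤M}}))
... | i′ , j′ , i<j , b^i≡b^j = j ∸ i , m<n⇒0<n∸m i<j , (c , b^[j-i]≡1+c , M∣c)
  where
    instance _ = >-nonZero 1≤M
    i = toℕ i′
    j = toℕ j′
    c = b ^ (j ∸ i) ∸ 1
    b^[j-i]≡1+c : b ^ (j ∸ i) ≡ 1 + c
    b^[j-i]≡1+c = sym (m+[n∸m]≡n (m^n>0 b {{>-nonZero b≥1}} (j ∸ i)))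
    b^j≡b^i+b^i*c : b ^ j ≡ b ^ i + b ^ i * c
    b^j≡b^i+b^i*c = begin
      b ^ j               ≡⟨ cong (b ^_) (m+[n∸m]≡n (<⇒≤ i<j)) ⟨
      b ^ (i + (j ∸ i))   ≡⟨ ^-distribˡ-+-* b i (j ∸ i) ⟩
      b ^ i * b ^ (j ∸ i) ≡⟨ cong (b ^ i *_) b^[j-i]≡1+c ⟩
      b ^ i * (1 + c)     ≡⟨ *-suc (b ^ i) c ⟩
      b ^ i + b ^ i * c   ∎
    b^i%M≡b^j%M : b ^ i % M ≡ b ^ j % M
    b^i%M≡b^j%M = trans (sym (toℕ-fromℕ< _)) (trans (cong toℕ b^i≡b^j) (toℕ-fromℕ< _))
    M∣c : M ∣ c
    M∣c = ∣b^i*c⇒∣c coprime i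
            (%-≡⇒∣ M (b ^ i) (b ^ i * c) (trans b^i%M≡b^j%M (cong (_% M) b^j≡b^i+b^i*c)))

multOrder-exists : ∀ {M b} → 1 ≤ M → 1 ≤ b → Coprime M b → ∃[ n ] MultOrder M b n
multOrder-exists {M} {b} 1≤M b≥1 coprime =
  let e , e≥1 , b^e≡1 = powerCongruentToOne 1≤M b≥1 coprime
      n , (n≥1 , M∣b^n-1) , least =
        leastWitness (λ j → 1 ≤? j ×-dec M ∣? (b ^ j ∸ 1)) (e≥1 , ≡1⇒∣∸1 b^e≡1)
  in n , n≥1 , M∣b^n-1 , λ j j≥1 M∣b^j-1 → least j (j≥1 , M∣b^j-1)

multOrder-≡1 : ∀ {M b n} → 1 ≤ b → MultOrder M b n → b ^ n ≡1[mod M ]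
multOrder-≡1 {b = b} {n} b≥1 (_ , M∣b^n-1 , _) = ∣∸1⇒≡1 (m^n>0 b {{>-nonZero b≥1}} n) M∣b^n-1

multOrder-∣ : ∀ {M b n c} → 1 ≤ b → MultOrder M b n → b ^ c ≡1[mod M ] → n ∣ c
multOrder-∣ {M} {b} {n} {c} b≥1 order@(n≥1 , _ , minimal) b^c≡1 =
  divides (c / n) (trans c≡r+qn (cong (_+ c / n * n) r≡0))
  where
    instance _ = >-nonZero n≥1
    r = c % n
    c≡r+qn : c ≡ r + c / n * n
    c≡r+qn = m≡m%n+[m/n]*n c n
    b^qn≡1 : b ^ (c / n * n) ≡1[mod M ]
    b^qn≡1 = subst (_≡1[mod M ]) (trans (^-*-assoc b n (c / n)) (cong (b ^_) (*-comm n (c / n))))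
                   (≡1-^ (c / n) (multOrder-≡1 b≥1 order))
    b^r≡1 : b ^ r ≡1[mod M ]
    b^r≡1 = ≡1-cancelˡ b^qn≡1 (subst (_≡1[mod M ])
      (trans (cong (b ^_) (trans c≡r+qn (+-comm r _))) (^-distribˡ-+-* b (c / n * n) r)) b^c≡1)
    r≡0 : r ≡ 0
    r≡0 = n≤0⇒n≡0 (≮⇒≥ (λ 0<r → <⇒≱ (m%n<n c n) (minimal r 0<r (≡1⇒∣∸1 b^r≡1))))

prime>1 : ∀ {p} → Prime p → 1 < p
prime>1 {p} pr = nonTrivial⇒n>1 p {{prime⇒nonTrivial pr}}

∣-coprime : ∀ {d m n} → d ∣ m → Coprime m n → Coprime d n
∣-coprime d∣m coprime (i∣d , i∣n) = coprime (∣-trans i∣d d∣m , i∣n)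

order∣p∸1 : ∀ {b N n p} → 1 ≤ b → Coprime N b → Coprime N n → MultOrder N b n →
  (∀ k d → n ≡ k * d → 1 < d → N ∣ geometric (b ^ k) d) → Prime p → p ∣ N → n ∣ p ∸ 1
order∣p∸1 {b} {N} {n} {p} b≥1 coprimeNb coprimeNn order N∣geometric pr p∣N =
  n∣p∸1 (quotient e∣n) (_∣_.equality e∣n)
  where
    orderModp : ∃[ e ] MultOrder p b e
    orderModp = multOrder-exists (<⇒≤ (prime>1 pr)) b≥1 (∣-coprime p∣N coprimeNb)
    e : ℕ
    e = proj₁ orderModp
    orderₚ : MultOrder p b e
    orderₚ = proj₂ orderModp
    e∣n : e ∣ n
    e∣n = multOrder-∣ b≥1 orderₚ (≡1-∣ p∣N (multOrder-≡1 b≥1 order))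
    p∤b : ¬ p ∣ b
    p∤b p∣b = ¬prime[1] (subst Prime (coprimeNb (p∣N , p∣b)) pr)
    n∣p∸1 : ∀ r → n ≡ r * e → n ∣ p ∸ 1
    n∣p∸1 zero                n≡0  = ⊥-elim (<⇒≢ (proj₁ order) (sym n≡0))
    n∣p∸1 (suc zero)          n≡e  =
      subst (_∣ p ∸ 1) (sym (trans n≡e (+-identityʳ e))) (multOrder-∣ b≥1 orderₚ (fermat pr p∤b))
    n∣p∸1 r@(suc (suc _)) n≡re = ⊥-elim (¬prime[1] (subst Prime (coprimeNn (p∣N , p∣n)) pr))
      where
        n≡er : n ≡ e * r
        n≡er = trans n≡re (*-comm r e)
        p∣r : p ∣ r
        p∣r = ∣geometric⇒∣length (multOrder-≡1 b≥1 orderₚ) r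
                (∣-trans p∣N (N∣geometric e r n≡er (s≤s (s≤s z≤n))))
        p∣n : p ∣ n
        p∣n = ∣-trans p∣r (divides e n≡er)

primeFactors≡1⇒≡1 : ∀ {N n} → 1 ≤ N → (∀ p → Prime p → p ∣ N → p ≡1[mod n ]) → N ≡1[mod n ]
primeFactors≡1⇒≡1 {N} {n} N≥1 p≡1 with factorise N {{>-nonZero N≥1}}
... | record { factors = ps ; isFactorisation = N≡∏ps ; factorsPrime = primes } =
  subst (_≡1[mod n ]) (sym N≡∏ps) (product≡1 ps primes (subst (_∣ N) N≡∏ps ∣-refl))
  where
    product≡1 : ∀ ps → All Prime ps → product ps ∣ N → product ps ≡1[mod n ]
    product≡1 []       []            _      = ≡1-refl
    product≡1 (p ∷ ps) (pr ∷ primes) p*ps∣N =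
      ≡1-* (p≡1 p pr (∣-trans (m∣m*n (product ps)) p*ps∣N))
           (product≡1 ps primes (∣-trans (n∣m*n p) p*ps∣N))

-- The strong pseudoprime condition

even⊎odd : ∀ c → 2 ∣ c ⊎ ∃[ c′ ] c ≡ 1 + 2 * c′
even⊎odd zero          = inj₁ (2 ∣0)
even⊎odd (suc zero)    = inj₂ (0 , refl)
even⊎odd (suc (suc c)) with even⊎odd c
... | inj₁ (divides q c≡2q) = inj₁ (divides (suc q) (cong (2 +_) c≡2q))
... | inj₂ (c′ , c≡1+2c′)   =
  inj₂ (suc c′ , trans (cong (2 +_) c≡1+2c′) (cong suc (sym (*-suc 2 c′))))

splitTwoPower : ∀ {n t} s → n ∣ 2 ^ s * t →
  n ∣ t ⊎ ∃[ i ] (i < s × ¬ n ∣ 2 ^ i * t × n ∣ 2 * (2 ^ i * t))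
splitTwoPower {n} {t} zero    n∣t = inj₁ (subst (n ∣_) (+-identityʳ t) n∣t)
splitTwoPower {n} {t} (suc s) n∣2^[1+s]t with n ∣? 2 ^ s * t
... | no  n∤2^st = inj₂ (s , ≤-refl , n∤2^st , subst (n ∣_) (*-assoc 2 (2 ^ s) t) n∣2^[1+s]t)
... | yes n∣2^st with splitTwoPower s n∣2^st
...   | inj₁ n∣t                  = inj₁ n∣t
...   | inj₂ (i , i<s , n∤ , n∣) = inj₂ (i , m<n⇒m<1+n i<s , n∤ , n∣)

halve-odd*n≡2*h : ∀ {n h} c′ → (1 + 2 * c′) * n ≡ 2 * h → ∃[ k ] n ≡ k * 2 × h ≡ k * (1 + 2 * c′)
halve-odd*n≡2*h {n} {h} c′ cn≡2h
  with ∣m+n∣m⇒∣n (subst (2 ∣_) (trans (sym cn≡2h) (expand c′ n)) (m∣m*n h)) (m∣m*n (c′ * n))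
  where expand : ∀ c′ n → (1 + 2 * c′) * n ≡ 2 * (c′ * n) + n
        expand = solve-∀
... | divides k n≡k*2 =
  k , n≡k*2 , *-cancelˡ-≡ h _ 2 (trans (sym cn≡2h) (trans (cong ((1 + 2 * c′) *_) n≡k*2) (regroup c′ k)))
  where regroup : ∀ c′ k → (1 + 2 * c′) * (k * 2) ≡ 2 * (k * (1 + 2 * c′))
        regroup = solve-∀

∣+1⇒^2≡1 : ∀ {N y} → N ∣ suc y + 1 → suc y ^ 2 ≡1[mod N ]
∣+1⇒^2≡1 {N} {y} N∣y+1 = y * (suc y + 1) , expand y , ∣n⇒∣m*n y N∣y+1
  where expand : ∀ y → suc y * (suc y * 1) ≡ 1 + y * (suc y + 1)
        expand = solve-∀

∣+1⇒∣^odd+1 : ∀ {N y} c → 1 ≤ y → N ∣ y + 1 → N ∣ y ^ (1 + 2 * c) + 1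
∣+1⇒∣^odd+1 {N} {suc y} c _ N∣y+1 with ≡1-^ c (∣+1⇒^2≡1 N∣y+1)
... | w , y²ᶜ≡1+w , N∣w = subst (N ∣_) (sym (begin
    suc y ^ (1 + 2 * c) + 1     ≡⟨ cong (λ z → suc y * z + 1) (^-*-assoc (suc y) 2 c) ⟨
    suc y * (suc y ^ 2) ^ c + 1 ≡⟨ cong (λ z → suc y * z + 1) y²ᶜ≡1+w ⟩
    suc y * (1 + w) + 1         ≡⟨ regroup (suc y) w ⟩
    suc y + 1 + suc y * w       ∎)) (∣m∣n⇒∣m+n N∣y+1 (∣n⇒∣m*n (suc y) N∣w))
  where regroup : ∀ y w → y * (1 + w) + 1 ≡ y + 1 + y * w
        regroup = solve-∀

strongPseudoprimeCondition : ∀ {N b n} s t → 1 ≤ b → b ^ n ≡1[mod N ] →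
  (∀ k → n ≡ k * 2 → N ∣ b ^ k + 1) → n ∣ 2 ^ s * t →
  N ∣ b ^ t ∸ 1 ⊎ ∃[ i ] (i < s × N ∣ b ^ (2 ^ i * t) + 1)
strongPseudoprimeCondition {N} {b} {n} s t b≥1 b^n≡1 N∣b^k+1 n∣2^st with splitTwoPower s n∣2^st
... | inj₁ (divides q t≡qn) = inj₁ (≡1⇒∣∸1 (subst (_≡1[mod N ]) b^nq≡b^t (≡1-^ q b^n≡1)))
  where b^nq≡b^t : (b ^ n) ^ q ≡ b ^ t
        b^nq≡b^t = trans (^-*-assoc b n q) (cong (b ^_) (trans (*-comm n q) (sym t≡qn)))
... | inj₂ (i , i<s , n∤h , divides c 2h≡cn) with even⊎odd c
...   | inj₁ (divides c″ refl) =
  ⊥-elim (n∤h (divides c″ (*-cancelˡ-≡ _ _ 2 (trans 2h≡cn (regroup c″ n)))))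
  where regroup : ∀ c n → c * 2 * n ≡ 2 * (c * n)
        regroup = solve-∀
...   | inj₂ (c′ , refl) = inj₂ (i , i<s , oddCase (halve-odd*n≡2*h c′ (sym 2h≡cn)))
  where
    oddCase : ∃[ k ] n ≡ k * 2 × 2 ^ i * t ≡ k * (1 + 2 * c′) → N ∣ b ^ (2 ^ i * t) + 1
    oddCase (k , n≡k*2 , h≡k*c) = subst (λ e → N ∣ e + 1) b^kc≡b^h
                                    (∣+1⇒∣^odd+1 c′ (m^n>0 b {{>-nonZero b≥1}} k) (N∣b^k+1 k n≡k*2))
      where b^kc≡b^h : (b ^ k) ^ (1 + 2 * c′) ≡ b ^ (2 ^ i * t)
            b^kc≡b^h = trans (^-*-assoc b k (1 + 2 * c′)) (cong (b ^_) (sym h≡k*c))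

mainTheorem2 : (b N : ℕ) → 1 ≤ b → MidyNumber b N → StrongPseudoprime b N
mainTheorem2 b N b≥1 (oddN , compositeN , coprimeNb , midy) =
  oddN , compositeN , coprime-sym coprimeNb , λ s t N∸1≡2^st _ →
    strongPseudoprimeCondition s t b≥1 (multOrder-≡1 b≥1 order)
      (λ k n≡2k → subst (N ∣_) (geometric-2 (b ^ k)) (N∣geometric k 2 n≡2k (s≤s (s≤s z≤n))))
      (subst (n ∣_) N∸1≡2^st (≡1⇒∣∸1 N≡1))
  where
    1<N : 1 < N
    1<N = nonTrivial⇒n>1 N {{composite⇒nonTrivial compositeN}}
    n : ℕ
    n = proj₁ (multOrder-exists (<⇒≤ 1<N) b≥1 coprimeNb)
    order : MultOrder N b n
    order = proj₂ (multOrder-exists (<⇒≤ 1<N) b≥1 coprimeNb)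
    N∣geometric : ∀ k d → n ≡ k * d → 1 < d → N ∣ geometric (b ^ k) d
    N∣geometric k d n≡kd d>1 =
      midy⇒∣geometric {k = k} b≥1 1<N order n≡kd d>1 (proj₂ (midy n order) d d>1 (divides k n≡kd))
    N≡1 : N ≡1[mod n ]
    N≡1 = primeFactors≡1⇒≡1 (<⇒≤ 1<N) λ p pr p∣N →
      ∣∸1⇒≡1 (<⇒≤ (prime>1 pr))
        (order∣p∸1 b≥1 coprimeNb (proj₁ (midy n order)) order N∣geometric pr p∣N)
    geometric-2 : ∀ x → geometric x 2 ≡ x + 1
    geometric-2 x = trans (cong (1 +_) (*-identityʳ x)) (+-comm 1 x)
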